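{- Let $G$ be a non-trivial finite abelian group, let $H$ be a subgroup of $G$, and let $f$ be an automorphism of $\mathcal{P}_{0}(G)$ with trivial pullback. Then: (1) $f(H)=H$, and $f$ restricts to an automorphism of $\mathcal{P}_{0}(H)$ with trivial pullback. (2) There is an isomorphism of monoids $\mathcal{P}_{0,H}(G)\simeq \mathcal{P}_{0}(G/H)$. Moreover, $f$ restricts to an automorphism of $\mathcal{P}_{0,H}(G)$. (3) For every nonzero $a\in G$ there is $b\in G$ with $f(G_a)=G_b$. Moreover, if $\operatorname{ord}(a)\geq 3$, then $f(G_a)=G_a$.
   Context: For an additively written finite abelian group $G$, $\mathcal{P}_{0}(G)$ denotes the reduced power monoid of $G$: the set of all subsets of $G$ containing $0$, with setwise addition $X+Y=\{x+y : x\in X, y\in Y\}$ and identity $\{0\}$. Every automorphism $f$ of $\mathcal{P}_{0}(G)$ maps $2$-element sets to $2$-element sets; the pullback of $f$ is the bijection $g:G\to G$ with $g(0)=0$ and $f(\{0,a\})=\{0,g(a)\}$ for nonzero $a$; $f$ has trivial pullback if $g$ is the identity, i.e. $f(\{0,a\})=\{0,a\}$ for all $a\in G$. For $a\in G$, $G_a:=G\setminus\{a\}$. For a subgroup $H$ of $G$, $\mathcal{P}_{0,H}(G):=H+\mathcal{P}_{0}(G)=\{H+X: X\in\mathcal{P}_{0}(G)\}$, the set of elements of $\mathcal{P}_{0}(G)$ divisible by $H$; it is a subsemigroup of $\mathcal{P}_{0}(G)$ and a monoid with identity $H$. -}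

module Defs where

open import Level using (0ℓ)
open import Data.Bool using (Bool; true; false; _∧_; not; T)
open import Data.List using (List)
open import Data.Bool.ListAction using (any)
open import Data.List.Membership.Propositional using (_∈_)
open import Data.Nat using (ℕ; zero; suc; _≤_; _<_)
open import Data.Product using (Σ; _×_; ∃; ∃-syntax; _,_)
open import Relation.Nullary using (¬_; ⌊_⌋)
open import Relation.Binary.PropositionalEquality using (_≡_; _≢_)
open import Relation.Binary.Definitions using (DecidableEquality)
open import Function.Bundles using (_⇔_)

record FinAbGroup : Set₁ where
  infixl 6 _+_
  field
    Carrier  : Set
    _+_      : Carrier → Carrier → Carrier
    0#       : Carrier
    -_       : Carrier → Carrier
    +-assoc  : ∀ x y z → (x + y) + z ≡ x + (y + z)
    +-comm   : ∀ x y → x + y ≡ y + x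
    +-idʳ    : ∀ x → x + 0# ≡ x
    +-invʳ   : ∀ x → x + (- x) ≡ 0#
    _≟_      : DecidableEquality Carrier
    elements : List Carrier
    complete : ∀ x → x ∈ elements

module _ (G : FinAbGroup) where
  open FinAbGroup G

  NonTrivial : Set
  NonTrivial = ∃[ g ] (g ≢ 0#)

  _•_ : ℕ → Carrier → Carrier
  zero  • a = 0#
  suc n • a = (n • a) + a

  IsOrder : Carrier → ℕ → Set
  IsOrder a n = 1 ≤ n × n • a ≡ 0# × (∀ m → 1 ≤ m → m < n → m • a ≢ 0#)

  Subset : Set
  Subset = Carrier → Bool

  _∈ₛ_ : Carrier → Subset → Set
  x ∈ₛ X = T (X x)

  _≐_ : Subset → Subset → Set
  X ≐ Y = ∀ x → X x ≡ Y x

  _⊆_ : Subset → Subset → Set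
  X ⊆ Y = ∀ x → x ∈ₛ X → x ∈ₛ Y

  zeroSet : Subset
  zeroSet z = ⌊ z ≟ 0# ⌋

  -- the two-element (for a ≠ 0) set {0, a}
  pair0 : Carrier → Subset
  pair0 a z = not (not ⌊ z ≟ 0# ⌋ ∧ not ⌊ z ≟ a ⌋)

  G∖ : Carrier → Subset
  G∖ a z = not ⌊ z ≟ a ⌋

  _⊕_ : Subset → Subset → Subset
  (X ⊕ Y) z = any (λ x → any (λ y → X x ∧ (Y y ∧ ⌊ z ≟ (x + y) ⌋)) elements) elements

  P₀ : Subset → Set
  P₀ X = 0# ∈ₛ X

  IsSubgroup : Subset → Set
  IsSubgroup H = (0# ∈ₛ H)
               × (∀ x y → x ∈ₛ H → y ∈ₛ H → (x + y) ∈ₛ H)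
               × (∀ x → x ∈ₛ H → (- x) ∈ₛ H)

  P₀[_] : Subset → Subset → Set
  P₀[ H ] Y = ∃[ X ] (P₀ X × Y ≐ (H ⊕ X))

  IsAutOn : (M : Subset → Set) (e : Subset) (f : Subset → Subset) → Set
  IsAutOn M e f =
      (∀ X Y → X ≐ Y → f X ≐ f Y)
    × (∀ X → M X → M (f X))
    × (∀ X Y → M X → M Y → f (X ⊕ Y) ≐ (f X ⊕ f Y))
    × (f e ≐ e)
    × (∀ X Y → M X → M Y → f X ≐ f Y → X ≐ Y)
    × (∀ Y → M Y → ∃[ X ] (M X × f X ≐ Y))

  IsAutP₀ : (Subset → Subset) → Set
  IsAutP₀ f = IsAutOn P₀ zeroSet f

  TrivialPullback : (Subset → Subset) → Set
  TrivialPullback f = ∀ a → f (pair0 a) ≐ pair0 a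

-- Group homomorphisms, and the quotient G/H characterised up to
-- isomorphism: a finite abelian group Q with a surjective homomorphism
-- π : G → Q whose kernel is exactly H.

IsHom : (G Q : FinAbGroup) → (FinAbGroup.Carrier G → FinAbGroup.Carrier Q) → Set
IsHom G Q π = ∀ x y → π (x +G y) ≡ π x +Q π y
  where open FinAbGroup G renaming (_+_ to _+G_)
        open FinAbGroup Q renaming (_+_ to _+Q_)

IsQuotientMap : (G : FinAbGroup) (H : Subset G) (Q : FinAbGroup)
              → (FinAbGroup.Carrier G → FinAbGroup.Carrier Q) → Set
IsQuotientMap G H Q π =
    IsHom G Q π
  × (∀ q → ∃[ x ] (π x ≡ q))
  × (∀ x → (π x ≡ FinAbGroup.0# Q) ⇔ (_∈ₛ_ G x H))

IsMonoidIso : (G : FinAbGroup) (H : Subset G) (Q : FinAbGroup)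
            → (Subset G → Subset Q) → Set
IsMonoidIso G H Q φ =
    (∀ X Y → _≐_ G X Y → _≐_ Q (φ X) (φ Y))
  × (∀ X → P₀[_] G H X → P₀ Q (φ X))
  × (∀ X Y → P₀[_] G H X → P₀[_] G H Y → _≐_ Q (φ (_⊕_ G X Y)) (_⊕_ Q (φ X) (φ Y)))
  × (_≐_ Q (φ H) (zeroSet Q))
  × (∀ X Y → P₀[_] G H X → P₀[_] G H Y → _≐_ Q (φ X) (φ Y) → _≐_ G X Y)
  × (∀ Y → P₀ Q Y → ∃[ X ] (P₀[_] G H X × _≐_ Q (φ X) Y))

-- Trivial pullback means f fixes every pair {0,a}, hence every sum of pairs; a subgroup H
-- is the sum of its pairs {0,h}, so f(H) = H.  Then f(H + X) = H + f(X), which shows that f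
-- preserves both the subsets of H (X ⊆ H iff H + X = H) and the sets divisible by H.  Any
-- surjective homomorphism π : G → Q with kernel H turns P_{0,H}(G) into P₀(Q) by taking
-- images, since sets divisible by H are unions of cosets; G/H itself is built from
-- canonical coset representatives.  For (3), G_a + {0,x} = G for every x ≠ 0, a property
-- preserved by f, and a set with this property that misses a point b is G_b; so
-- f(G_a) = G_b.  If 2a ≠ 0 and b ≠ a, then G_b = {0,a} + (G ∖ {b, b − a}), and pulling
-- this back along f writes G_a as {0,a} + W, which contains a.

module Submission where

open import Defs
open import Data.Nat using (_≤_; s≤s; z≤n)
open import Data.Product using (Σ; _×_; ∃; ∃-syntax; ∃₂; _,_; proj₁; proj₂)
open import Relation.Binary.PropositionalEquality

open import Level using (0ℓ)
open import Algebra.Bundles using (AbelianGroup)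
import Algebra.Properties.AbelianGroup as AbelianGroupProperties
import Algebra.Properties.Quasigroup as QuasigroupProperties
open import Axiom.UniquenessOfIdentityProofs using (module Decidable⇒UIP)
open import Data.Bool using (Bool; true; false; T; _∧_; if_then_else_)
open import Data.Bool.Properties using (T-∧; T-≡; ⇔→≡)
open import Data.Bool.ListAction using (any)
open import Data.Empty using (⊥; ⊥-elim)
open import Data.List using (List; []; _∷_; foldr; filterᵇ; map)
open import Data.List.Membership.Propositional using (_∈_; lose)
open import Data.List.Membership.Propositional.Properties using (∈-filter⁺; ∈-map⁺)
open import Data.List.Relation.Unary.All as All using (All; []; _∷_; all?)
open import Data.List.Relation.Unary.All.Properties using (all-filter; ¬All⇒Any¬)
open import Data.List.Relation.Unary.Any using (here; there; satisfied)
open import Data.List.Relation.Unary.Any.Properties using (any⁺; any⁻)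
open import Data.Sum using (_⊎_; inj₁; inj₂)
open import Data.Unit using (tt)
open import Function using (_∘_; mk⇔; Equivalence)
open import Relation.Binary.Bundles using (Setoid)
open import Relation.Nullary using (¬_; Dec; yes; no; ⌊_⌋)
open import Relation.Nullary.Decidable
  using (T?; toWitness; fromWitness; toWitnessFalse; fromWitnessFalse)

firstWith : {A : Set} → (A → Bool) → A → List A → A
firstWith p d []       = d
firstWith p d (x ∷ xs) = if p x then x else firstWith p d xs

firstWith-satisfies : {A : Set} (p : A → Bool) (d : A) {x : A} {xs : List A}
  → x ∈ xs → T (p x) → T (p (firstWith p d xs))
firstWith-satisfies p d {xs = y ∷ ys} x∈xs px with p y in py
... | true  = subst T (sym py) tt
... | false with x∈xs
...   | here refl  = ⊥-elim (subst T py px)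
...   | there x∈ys = firstWith-satisfies p d x∈ys px

firstWith-cong : {A : Set} {p q : A → Bool} (d : A) (xs : List A)
  → (∀ x → p x ≡ q x) → firstWith p d xs ≡ firstWith q d xs
firstWith-cong d []       p≗q = refl
firstWith-cong {q = q} d (x ∷ xs) p≗q rewrite p≗q x with q x
... | true  = refl
... | false = firstWith-cong d xs p≗q

module GroupProperties (G : FinAbGroup) where
  open FinAbGroup G

  +-identityˡ : ∀ x → 0# + x ≡ x
  +-identityˡ x = trans (+-comm 0# x) (+-idʳ x)

  abelianGroup : AbelianGroup 0ℓ 0ℓ
  abelianGroup = record
    { Carrier = Carrier ; _≈_ = _≡_ ; _∙_ = _+_ ; ε = 0# ; _⁻¹ = -_
    ; isAbelianGroup = record
      { isGroup = record
        { isMonoid = record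
          { isSemigroup = record
            { isMagma = record { isEquivalence = isEquivalence ; ∙-cong = cong₂ _+_ }
            ; assoc = +-assoc }
          ; identity = +-identityˡ , +-idʳ }
        ; inverse = (λ x → trans (+-comm (- x) x) (+-invʳ x)) , +-invʳ
        ; ⁻¹-cong = cong -_ }
      ; comm = +-comm } }

  open AbelianGroup abelianGroup public using (_-_)
  open AbelianGroupProperties abelianGroup public
    using (x∙y⁻¹≈ε⇒x≈y; ⁻¹-anti-homo‿-; ⁻¹-∙-comm; ⁻¹-injective; ε⁻¹≈ε; //-rightDividesˡ; quasigroup)
  open QuasigroupProperties quasigroup public using (cancelˡ; cancelʳ)

  x-y+y≡x : ∀ x y → (x - y) + y ≡ x
  x-y+y≡x x y = //-rightDividesˡ y x

  x+[y-x]≡y : ∀ x y → x + (y - x) ≡ y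
  x+[y-x]≡y x y = trans (+-comm x (y - x)) (x-y+y≡x y x)

  x-0≡x : ∀ x → x - 0# ≡ x
  x-0≡x x = trans (cong (x +_) ε⁻¹≈ε) (+-idʳ x)

  a+a≢0⇒a≢0 : ∀ {a} → a + a ≢ 0# → a ≢ 0#
  a+a≢0⇒a≢0 2a≢0 refl = 2a≢0 (+-idʳ 0#)

  order≥3⇒a+a≢0 : ∀ {a n} → IsOrder G a n → 3 ≤ n → a + a ≢ 0#
  order≥3⇒a+a≢0 {a} (_ , _ , minimal) 3≤n a+a≡0 =
    minimal 2 (s≤s z≤n) 3≤n (trans (cong (_+ a) (+-identityˡ a)) a+a≡0)

  x-y≡0⇒x≡y : ∀ {x y} → x - y ≡ 0# → x ≡ y
  x-y≡0⇒x≡y {x} {y} = x∙y⁻¹≈ε⇒x≈y x y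

  x-y≡x⇒y≡0 : ∀ {x y} → x - y ≡ x → y ≡ 0#
  x-y≡x⇒y≡0 {x} {y} e =
    ⁻¹-injective (trans (cancelˡ x (- y) 0# (trans e (sym (+-idʳ x)))) (sym ε⁻¹≈ε))

  x+y≡z⇒y≡z-x : ∀ {x y z} → x + y ≡ z → y ≡ z - x
  x+y≡z⇒y≡z-x {x} {y} {z} e = cancelˡ x y (z - x) (trans e (sym (x+[y-x]≡y x z)))

  [x-y]-z≡x-[y+z] : ∀ x y z → (x - y) - z ≡ x - (y + z)
  [x-y]-z≡x-[y+z] x y z = trans (+-assoc x (- y) (- z)) (cong (x +_) (⁻¹-∙-comm y z))

  [x-y]+[y-z]≡x-z : ∀ x y z → (x - y) + (y - z) ≡ x - z
  [x-y]+[y-z]≡x-z x y z = begin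
    (x - y) + (y - z)  ≡⟨ +-assoc x (- y) (y - z) ⟩
    x + (- y + (y - z)) ≡⟨ cong (x +_) (sym (+-assoc (- y) y (- z))) ⟩
    x + ((- y + y) - z) ≡⟨ cong (λ t → x + (t - z)) (trans (+-comm (- y) y) (+-invʳ y)) ⟩
    x + (0# - z)       ≡⟨ cong (x +_) (+-identityˡ (- z)) ⟩
    x - z              ∎
    where open ≡-Reasoning

  [x+y]-[u+v]≡[x-u]+[y-v] : ∀ x y u v → (x + y) - (u + v) ≡ (x - u) + (y - v)
  [x+y]-[u+v]≡[x-u]+[y-v] x y u v = begin
    (x + y) - (u + v)     ≡⟨ cong ((x + y) +_) (sym (⁻¹-∙-comm u v)) ⟩
    (x + y) + (- u - v)   ≡⟨ +-assoc x y (- u - v) ⟩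
    x + (y + (- u - v))   ≡⟨ cong (x +_) (sym (+-assoc y (- u) (- v))) ⟩
    x + ((y - u) - v)     ≡⟨ cong (λ t → x + (t - v)) (+-comm y (- u)) ⟩
    x + ((- u + y) - v)   ≡⟨ cong (x +_) (+-assoc (- u) y (- v)) ⟩
    x + (- u + (y - v))   ≡⟨ sym (+-assoc x (- u) (y - v)) ⟩
    (x - u) + (y - v)     ∎
    where open ≡-Reasoning

module SubsetProperties (G : FinAbGroup) where
  open FinAbGroup G
  open GroupProperties G

  private variable
    a b x y z : Carrier
    X X′ Y Y′ H : Subset G

  ⊆-antisym : _⊆_ G X Y → _⊆_ G Y X → _≐_ G X Y
  ⊆-antisym X⊆Y Y⊆X x =
    ⇔→≡ {z = true} (mk⇔ (to T-≡ ∘ X⊆Y x ∘ from T-≡) (to T-≡ ∘ Y⊆X x ∘ from T-≡))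
    where open Equivalence

  ≐⇒⊆ : _≐_ G X Y → _⊆_ G X Y
  ≐⇒⊆ X≐Y x = subst T (X≐Y x)

  ≐-setoid : Setoid 0ℓ 0ℓ
  ≐-setoid = record
    { Carrier = Subset G
    ; _≈_ = _≐_ G
    ; isEquivalence = record
      { refl = λ _ → refl
      ; sym = λ X≐Y x → sym (X≐Y x)
      ; trans = λ X≐Y Y≐Z x → trans (X≐Y x) (Y≐Z x) } }

  open Setoid ≐-setoid public using () renaming (refl to ≐-refl; sym to ≐-sym; trans to ≐-trans)

  full : Subset G
  full _ = true

  full-isSubgroup : IsSubgroup G full
  full-isSubgroup = tt , (λ _ _ _ _ → tt) , (λ _ _ → tt)

  0∈zeroSet : _∈ₛ_ G 0# (zeroSet G)
  0∈zeroSet = fromWitness refl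

  ∈zeroSet⁻ : _∈ₛ_ G x (zeroSet G) → x ≡ 0#
  ∈zeroSet⁻ = toWitness

  0∈pair0 : ∀ a → _∈ₛ_ G 0# (pair0 G a)
  0∈pair0 a with 0# ≟ 0#
  ... | yes _ = tt
  ... | no 0≢0 = ⊥-elim (0≢0 refl)

  a∈pair0 : ∀ a → _∈ₛ_ G a (pair0 G a)
  a∈pair0 a with a ≟ 0# | a ≟ a
  ... | yes _ | _ = tt
  ... | no _ | yes _ = tt
  ... | no _ | no a≢a = ⊥-elim (a≢a refl)

  ∈pair0⁻ : _∈ₛ_ G x (pair0 G a) → x ≡ 0# ⊎ x ≡ a
  ∈pair0⁻ {x} {a} x∈ with x ≟ 0# | x ≟ a
  ... | yes x≡0 | _ = inj₁ x≡0
  ... | no _ | yes x≡a = inj₂ x≡a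

  ∈G∖⁺ : x ≢ a → _∈ₛ_ G x (G∖ G a)
  ∈G∖⁺ = fromWitnessFalse

  ∈G∖⁻ : _∈ₛ_ G x (G∖ G a) → x ≢ a
  ∈G∖⁻ = toWitnessFalse

  0∈G∖ : a ≢ 0# → P₀ G (G∖ G a)
  0∈G∖ a≢0 = ∈G∖⁺ (a≢0 ∘ sym)

  ∈⊕⁺ : ∀ X Y → _∈ₛ_ G x X → _∈ₛ_ G y Y → z ≡ x + y → _∈ₛ_ G z (_⊕_ G X Y)
  ∈⊕⁺ {x} {y} X Y x∈X y∈Y refl =
    any⁺ _ (lose (complete x) (any⁺ _ (lose (complete y)
      (from T-∧ (x∈X , from T-∧ (y∈Y , fromWitness refl))))))
    where open Equivalence

  ∈⊕⁻ : ∀ X Y → _∈ₛ_ G z (_⊕_ G X Y) → ∃₂ λ x y → _∈ₛ_ G x X × _∈ₛ_ G y Y × z ≡ x + y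
  ∈⊕⁻ X Y z∈ =
    let x , p = satisfied (any⁻ _ elements z∈)
        y , q = satisfied (any⁻ _ elements p)
        x∈X , r = to T-∧ q
        y∈Y , s = to T-∧ r
    in x , y , x∈X , y∈Y , toWitness s
    where open Equivalence

  ⊕-mono : _⊆_ G X X′ → _⊆_ G Y Y′ → _⊆_ G (_⊕_ G X Y) (_⊕_ G X′ Y′)
  ⊕-mono {X} {X′} {Y} {Y′} X⊆X′ Y⊆Y′ z z∈ =
    let x , y , x∈X , y∈Y , z≡x+y = ∈⊕⁻ X Y z∈
    in ∈⊕⁺ X′ Y′ (X⊆X′ x x∈X) (Y⊆Y′ y y∈Y) z≡x+y

  ⊕-cong : _≐_ G X X′ → _≐_ G Y Y′ → _≐_ G (_⊕_ G X Y) (_⊕_ G X′ Y′)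
  ⊕-cong X≐X′ Y≐Y′ = ⊆-antisym (⊕-mono (≐⇒⊆ X≐X′) (≐⇒⊆ Y≐Y′))
                               (⊕-mono (≐⇒⊆ (≐-sym X≐X′)) (≐⇒⊆ (≐-sym Y≐Y′)))

  P₀-⊕ : ∀ X Y → P₀ G X → P₀ G Y → P₀ G (_⊕_ G X Y)
  P₀-⊕ X Y 0∈X 0∈Y = ∈⊕⁺ X Y 0∈X 0∈Y (sym (+-idʳ 0#))

  P₀[]⇒P₀ : P₀ G H → P₀[_] G H X → P₀ G X
  P₀[]⇒P₀ {H} 0∈H (X′ , 0∈X′ , X≐H⊕X′) = subst T (sym (X≐H⊕X′ 0#)) (P₀-⊕ H X′ 0∈H 0∈X′)

  ⊆⇒⊕≐ : IsSubgroup G H → P₀ G X → _⊆_ G X H → _≐_ G (_⊕_ G H X) H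
  ⊆⇒⊕≐ {H} {X} (_ , +-closed , _) 0∈X X⊆H = ⊆-antisym
    (λ z z∈ → let h , x , h∈H , x∈X , z≡h+x = ∈⊕⁻ H X z∈
              in subst (λ t → _∈ₛ_ G t H) (sym z≡h+x) (+-closed h x h∈H (X⊆H x x∈X)))
    (λ z z∈H → ∈⊕⁺ H X z∈H 0∈X (sym (+-idʳ z)))

  ⊕≐⇒⊆ : P₀ G H → _≐_ G (_⊕_ G H X) H → _⊆_ G X H
  ⊕≐⇒⊆ {H} {X} 0∈H H⊕X≐H x x∈X = ≐⇒⊆ H⊕X≐H x (∈⊕⁺ H X 0∈H x∈X (sym (+-identityˡ x)))

  span : List Carrier → Subset G
  span = foldr (λ a S → _⊕_ G (pair0 G a) S) (zeroSet G)

  0∈span : ∀ L → _∈ₛ_ G 0# (span L)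
  0∈span []      = 0∈zeroSet
  0∈span (a ∷ L) = P₀-⊕ (pair0 G a) (span L) (0∈pair0 a) (0∈span L)

  ∈span : ∀ {L} → a ∈ L → _∈ₛ_ G a (span L)
  ∈span {a} {b ∷ L} (here refl) = ∈⊕⁺ (pair0 G a) (span L) (a∈pair0 a) (0∈span L) (sym (+-idʳ a))
  ∈span {a} {b ∷ L} (there a∈L) = ∈⊕⁺ (pair0 G b) (span L) (0∈pair0 b) (∈span a∈L) (sym (+-identityˡ a))

  span⊆ : IsSubgroup G H → ∀ L → All (λ a → _∈ₛ_ G a H) L → _⊆_ G (span L) H
  span⊆ {H} (0∈H , _ , _) [] [] x x∈ = subst (λ t → _∈ₛ_ G t H) (sym (∈zeroSet⁻ x∈)) 0∈H
  span⊆ {H} H-sub@(0∈H , +-closed , _) (a ∷ L) (a∈H ∷ L⊆H) x x∈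
    with ∈⊕⁻ (pair0 G a) (span L) x∈
  ... | u , v , u∈ , v∈ , refl with ∈pair0⁻ u∈
  ...   | inj₁ refl = +-closed _ v 0∈H (span⊆ H-sub L L⊆H v v∈)
  ...   | inj₂ refl = +-closed _ v a∈H (span⊆ H-sub L L⊆H v v∈)

  subgroup≐span : IsSubgroup G H → _≐_ G H (span (filterᵇ H elements))
  subgroup≐span {H} H-sub = ⊆-antisym
    (λ x x∈H → ∈span (∈-filter⁺ (T? ∘ H) (complete x) x∈H))
    (span⊆ H-sub _ (all-filter (T? ∘ H) elements))

  ≐full⊎∉ : ∀ X → _≐_ G X full ⊎ ∃ λ b → ¬ _∈ₛ_ G b X
  ≐full⊎∉ X with all? (T? ∘ X) elements
  ... | yes X-all = inj₁ (⊆-antisym (λ _ _ → tt) (λ x _ → All.lookup X-all (complete x)))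
  ... | no ¬X-all = inj₂ (satisfied (¬All⇒Any¬ (T? ∘ X) elements ¬X-all))

  FillsWithPairs : Subset G → Set
  FillsWithPairs X = ∀ x → x ≢ 0# → _≐_ G (_⊕_ G X (pair0 G x)) full

  G∖-fillsWithPairs : ∀ a → FillsWithPairs (G∖ G a)
  G∖-fillsWithPairs a x x≢0 = ⊆-antisym (λ _ _ → tt) (λ z _ → z∈ z)
    where
    z∈ : ∀ z → _∈ₛ_ G z (_⊕_ G (G∖ G a) (pair0 G x))
    z∈ z with z ≟ a
    ... | no z≢a = ∈⊕⁺ (G∖ G a) (pair0 G x) (∈G∖⁺ z≢a) (0∈pair0 x) (sym (+-idʳ z))
    ... | yes refl = ∈⊕⁺ (G∖ G z) (pair0 G x) (∈G∖⁺ (x≢0 ∘ x-y≡x⇒y≡0)) (a∈pair0 x)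
                        (sym (x-y+y≡x z x))

  fillsWithPairs⇒≐G∖ : FillsWithPairs X → ¬ _∈ₛ_ G b X → _≐_ G X (G∖ G b)
  fillsWithPairs⇒≐G∖ {X} {b} X-fills b∉X = ⊆-antisym
    (λ x x∈X → ∈G∖⁺ λ { refl → b∉X x∈X })
    (λ z z∈ → z∈X z (∈G∖⁻ z∈))
    where
    -- Since b ∉ X, the decomposition of b ∈ X + {0, b − z} must be x + (b − z), forcing x = z.
    z∈X : ∀ z → z ≢ b → _∈ₛ_ G z X
    z∈X z z≢b with ∈⊕⁻ X (pair0 G (b - z))
                      (≐⇒⊆ (≐-sym (X-fills (b - z) (z≢b ∘ sym ∘ x-y≡0⇒x≡y))) b tt)
    ... | u , v , u∈X , v∈ , b≡u+v with ∈pair0⁻ v∈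
    ...   | inj₁ refl = ⊥-elim (b∉X (subst (λ t → _∈ₛ_ G t X) (trans (sym (+-idʳ u)) (sym b≡u+v)) u∈X))
    ...   | inj₂ refl = subst (λ t → _∈ₛ_ G t X)
                          (cancelʳ (b - z) u z (trans (sym b≡u+v) (sym (x+[y-x]≡y z b)))) u∈X

  G∖₂ : Carrier → Carrier → Subset G
  G∖₂ b c x = G∖ G b x ∧ G∖ G c x

  ∈G∖₂⁺ : x ≢ b → x ≢ a → _∈ₛ_ G x (G∖₂ b a)
  ∈G∖₂⁺ x≢b x≢a = Equivalence.from T-∧ (∈G∖⁺ x≢b , ∈G∖⁺ x≢a)

  ∈G∖₂⁻ : _∈ₛ_ G x (G∖₂ b a) → x ≢ b × x ≢ a
  ∈G∖₂⁻ x∈ = let x∈G∖b , x∈G∖a = Equivalence.to T-∧ x∈ in ∈G∖⁻ x∈G∖b , ∈G∖⁻ x∈G∖a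

  G∖≐pair0⊕G∖₂ : a + a ≢ 0# → _≐_ G (G∖ G b) (_⊕_ G (pair0 G a) (G∖₂ b (b - a)))
  G∖≐pair0⊕G∖₂ {a} {b} 2a≢0 = ⊆-antisym
    (λ z z∈ → split z (∈G∖⁻ z∈) (z ≟ (b - a)))
    (λ z z∈ → let u , v , u∈ , v∈ , z≡u+v = ∈⊕⁻ (pair0 G a) (G∖₂ b (b - a)) z∈
              in ∈G∖⁺ λ z≡b → ∉ u v (∈pair0⁻ u∈) (∈G∖₂⁻ v∈) (trans (sym z≡b) z≡u+v))
    where
    split : ∀ z → z ≢ b → Dec (z ≡ b - a) → _∈ₛ_ G z (_⊕_ G (pair0 G a) (G∖₂ b (b - a)))
    split z z≢b (no z≢b-a) =
      ∈⊕⁺ (pair0 G a) (G∖₂ b (b - a)) (0∈pair0 a) (∈G∖₂⁺ z≢b z≢b-a) (sym (+-identityˡ z))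
    -- z = b − a is a + (z − a), and z − a = b − 2a differs from b because 2a ≠ 0.
    split z z≢b (yes refl) =
      ∈⊕⁺ (pair0 G a) (G∖₂ b (b - a)) (a∈pair0 a)
        (∈G∖₂⁺ (2a≢0 ∘ x-y≡x⇒y≡0 ∘ trans (sym ([x-y]-z≡x-[y+z] b a a)))
               (z≢b ∘ cancelʳ (- a) z b))
        (sym (x+[y-x]≡y a z))
    ∉ : ∀ u v → u ≡ 0# ⊎ u ≡ a → v ≢ b × v ≢ b - a → b ≢ u + v
    ∉ u v (inj₁ refl) (v≢b , _) b≡u+v = v≢b (trans (sym (+-identityˡ v)) (sym b≡u+v))
    ∉ u v (inj₂ refl) (_ , v≢b-a) b≡u+v = v≢b-a (x+y≡z⇒y≡z-x (sym b≡u+v))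

module AutomorphismProperties (G : FinAbGroup) {f : Subset G → Subset G} (f-aut : IsAutP₀ G f) where
  open FinAbGroup G
  open GroupProperties G
  open SubsetProperties G
  open import Relation.Binary.Reasoning.Setoid ≐-setoid

  f-cong : ∀ X Y → _≐_ G X Y → _≐_ G (f X) (f Y)
  f-cong = proj₁ f-aut

  f-P₀ : ∀ X → P₀ G X → P₀ G (f X)
  f-P₀ = proj₁ (proj₂ f-aut)

  f-⊕ : ∀ X Y → P₀ G X → P₀ G Y → _≐_ G (f (_⊕_ G X Y)) (_⊕_ G (f X) (f Y))
  f-⊕ = proj₁ (proj₂ (proj₂ f-aut))

  f-zeroSet : _≐_ G (f (zeroSet G)) (zeroSet G)
  f-zeroSet = proj₁ (proj₂ (proj₂ (proj₂ f-aut)))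

  f-injective : ∀ X Y → P₀ G X → P₀ G Y → _≐_ G (f X) (f Y) → _≐_ G X Y
  f-injective = proj₁ (proj₂ (proj₂ (proj₂ (proj₂ f-aut))))

  f-surjective : ∀ Y → P₀ G Y → ∃[ X ] (P₀ G X × _≐_ G (f X) Y)
  f-surjective = proj₂ (proj₂ (proj₂ (proj₂ (proj₂ f-aut))))

  isAutOn-submonoid : {M : Subset G → Set} {e : Subset G}
    → (∀ X → M X → P₀ G X) → _≐_ G (f e) e
    → (∀ X → M X → M (f X)) → (∀ Y → M Y → ∃[ X ] (M X × _≐_ G (f X) Y))
    → IsAutOn G M e f
  isAutOn-submonoid M⊆P₀ fe≐e f-M f⁻¹-M =
      f-cong , f-M , (λ X Y MX MY → f-⊕ X Y (M⊆P₀ X MX) (M⊆P₀ Y MY)) , fe≐e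
    , (λ X Y MX MY → f-injective X Y (M⊆P₀ X MX) (M⊆P₀ Y MY)) , f⁻¹-M

  module _ {H : Subset G} (0∈H : P₀ G H) (fH≐H : _≐_ G (f H) H) where

    f-H⊕ : ∀ X → P₀ G X → _≐_ G (f (_⊕_ G H X)) (_⊕_ G H (f X))
    f-H⊕ X 0∈X = ≐-trans (f-⊕ H X 0∈H 0∈X) (⊕-cong {Y = f X} fH≐H ≐-refl)

    isAutOn-P₀[] : IsAutOn G (P₀[_] G H) H f
    isAutOn-P₀[] = isAutOn-submonoid (λ _ → P₀[]⇒P₀ {H = H} 0∈H) fH≐H f-P₀[] f⁻¹-P₀[]
      where
      f-P₀[] : ∀ Y → P₀[_] G H Y → P₀[_] G H (f Y)
      f-P₀[] Y (X , 0∈X , Y≐H⊕X) = f X , f-P₀ X 0∈X , ≐-trans (f-cong _ _ Y≐H⊕X) (f-H⊕ X 0∈X)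

      f⁻¹-P₀[] : ∀ Y → P₀[_] G H Y → ∃[ X ] (P₀[_] G H X × _≐_ G (f X) Y)
      f⁻¹-P₀[] Y (X′ , 0∈X′ , Y≐H⊕X′) with f-surjective X′ 0∈X′
      ... | X , 0∈X , fX≐X′ = _⊕_ G H X , (X , 0∈X , ≐-refl) , (begin
        f (_⊕_ G H X)   ≈⟨ f-H⊕ X 0∈X ⟩
        _⊕_ G H (f X)   ≈⟨ ⊕-cong {X = H} ≐-refl fX≐X′ ⟩
        _⊕_ G H X′      ≈⟨ Y≐H⊕X′ ⟨
        Y               ∎)

  isAutOn-⊆ : ∀ {H} → IsSubgroup G H → _≐_ G (f H) H
    → IsAutOn G (λ X → P₀ G X × _⊆_ G X H) (zeroSet G) f
  isAutOn-⊆ {H} H-sub@(0∈H , _) fH≐H = isAutOn-submonoid (λ _ → proj₁) f-zeroSet f-⊆ f⁻¹-⊆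
    where
    f-⊆ : ∀ X → P₀ G X × _⊆_ G X H → P₀ G (f X) × _⊆_ G (f X) H
    f-⊆ X (0∈X , X⊆H) = f-P₀ X 0∈X , ⊕≐⇒⊆ 0∈H (begin
      _⊕_ G H (f X)   ≈⟨ f-H⊕ 0∈H fH≐H X 0∈X ⟨
      f (_⊕_ G H X)   ≈⟨ f-cong _ _ (⊆⇒⊕≐ H-sub 0∈X X⊆H) ⟩
      f H             ≈⟨ fH≐H ⟩
      H               ∎)

    f⁻¹-⊆ : ∀ Y → P₀ G Y × _⊆_ G Y H → ∃[ X ] ((P₀ G X × _⊆_ G X H) × _≐_ G (f X) Y)
    f⁻¹-⊆ Y (0∈Y , Y⊆H) with f-surjective Y 0∈Y
    ... | X , 0∈X , fX≐Y = X , (0∈X , ⊕≐⇒⊆ 0∈H H⊕X≐H) , fX≐Y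
      where
      H⊕X≐H : _≐_ G (_⊕_ G H X) H
      H⊕X≐H = f-injective _ H (P₀-⊕ H X 0∈H 0∈X) 0∈H (begin
        f (_⊕_ G H X)   ≈⟨ f-H⊕ 0∈H fH≐H X 0∈X ⟩
        _⊕_ G H (f X)   ≈⟨ ⊕-cong {X = H} ≐-refl fX≐Y ⟩
        _⊕_ G H Y       ≈⟨ ⊆⇒⊕≐ H-sub 0∈Y Y⊆H ⟩
        H               ≈⟨ fH≐H ⟨
        f H             ∎)

  module _ (trivial : TrivialPullback G f) where

    f-span : ∀ L → _≐_ G (f (span L)) (span L)
    f-span []      = f-zeroSet
    f-span (a ∷ L) = ≐-trans (f-⊕ (pair0 G a) (span L) (0∈pair0 a) (0∈span L))
                             (⊕-cong (trivial a) (f-span L))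

    f-subgroup : ∀ {H} → IsSubgroup G H → _≐_ G (f H) H
    f-subgroup {H} H-sub = begin
      f H      ≈⟨ f-cong _ _ (subgroup≐span H-sub) ⟩
      f (span L) ≈⟨ f-span L ⟩
      span L   ≈⟨ subgroup≐span H-sub ⟨
      H        ∎
      where L = filterᵇ H elements

    f-full : _≐_ G (f full) full
    f-full = f-subgroup full-isSubgroup

    f-fillsWithPairs : ∀ {X} → P₀ G X → FillsWithPairs X → FillsWithPairs (f X)
    f-fillsWithPairs {X} 0∈X X-fills x x≢0 = begin
      _⊕_ G (f X) (pair0 G x)      ≈⟨ ⊕-cong {X = f X} ≐-refl (trivial x) ⟨
      _⊕_ G (f X) (f (pair0 G x))  ≈⟨ f-⊕ X (pair0 G x) 0∈X (0∈pair0 x) ⟨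
      f (_⊕_ G X (pair0 G x))      ≈⟨ f-cong _ _ (X-fills x x≢0) ⟩
      f full                       ≈⟨ f-full ⟩
      full                         ∎

    f-G∖ : ∀ {a} → a ≢ 0# → ∃[ b ] _≐_ G (f (G∖ G a)) (G∖ G b)
    f-G∖ {a} a≢0 with ≐full⊎∉ (f (G∖ G a))
    ... | inj₂ (b , b∉) = b , fillsWithPairs⇒≐G∖ (f-fillsWithPairs (0∈G∖ a≢0) (G∖-fillsWithPairs a)) b∉
    ... | inj₁ fG∖a≐full = ⊥-elim (∈G∖⁻ (≐⇒⊆ (≐-sym G∖a≐full) a tt) refl)
      where
      G∖a≐full : _≐_ G (G∖ G a) full
      G∖a≐full = f-injective _ full (0∈G∖ a≢0) tt (≐-trans fG∖a≐full (≐-sym f-full))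

    f-G∖≐G∖⇒≡ : ∀ {a b} → a + a ≢ 0# → _≐_ G (f (G∖ G a)) (G∖ G b) → b ≡ a
    f-G∖≐G∖⇒≡ {a} {b} 2a≢0 fG∖a≐G∖b with b ≟ a
    ... | yes b≡a = b≡a
    ... | no b≢a  = ⊥-elim (absurd (f-surjective (G∖₂ b (b - a)) 0∈G∖₂))
      where
      0∈G∖a : P₀ G (G∖ G a)
      0∈G∖a = 0∈G∖ (a+a≢0⇒a≢0 2a≢0)

      0∈G∖₂ : P₀ G (G∖₂ b (b - a))
      0∈G∖₂ = ∈G∖₂⁺ (λ 0≡b → ∈G∖⁻ (≐⇒⊆ fG∖a≐G∖b 0# (f-P₀ _ 0∈G∖a)) 0≡b)
                    (b≢a ∘ x-y≡0⇒x≡y ∘ sym)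

      absurd : ∃[ W ] (P₀ G W × _≐_ G (f W) (G∖₂ b (b - a))) → ⊥
      absurd (W , 0∈W , fW≐G∖₂) = ∈G∖⁻ (≐⇒⊆ pair0⊕W≐G∖a a a∈pair0⊕W) refl
        where
        a∈pair0⊕W : _∈ₛ_ G a (_⊕_ G (pair0 G a) W)
        a∈pair0⊕W = ∈⊕⁺ (pair0 G a) W (a∈pair0 a) 0∈W (sym (+-idʳ a))
        pair0⊕W≐G∖a : _≐_ G (_⊕_ G (pair0 G a) W) (G∖ G a)
        pair0⊕W≐G∖a = f-injective _ _ (P₀-⊕ (pair0 G a) W (0∈pair0 a) 0∈W) 0∈G∖a (begin
          f (_⊕_ G (pair0 G a) W)             ≈⟨ f-⊕ (pair0 G a) W (0∈pair0 a) 0∈W ⟩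
          _⊕_ G (f (pair0 G a)) (f W)         ≈⟨ ⊕-cong (trivial a) fW≐G∖₂ ⟩
          _⊕_ G (pair0 G a) (G∖₂ b (b - a))   ≈⟨ G∖≐pair0⊕G∖₂ 2a≢0 ⟨
          G∖ G b                              ≈⟨ fG∖a≐G∖b ⟨
          f (G∖ G a)                          ∎)

    f-G∖-fixed : ∀ {a} → a + a ≢ 0# → _≐_ G (f (G∖ G a)) (G∖ G a)
    f-G∖-fixed {a} 2a≢0 with f-G∖ (a+a≢0⇒a≢0 2a≢0)
    ... | b , fG∖a≐G∖b = subst (λ c → _≐_ G (f (G∖ G a)) (G∖ G c)) (f-G∖≐G∖⇒≡ 2a≢0 fG∖a≐G∖b) fG∖a≐G∖b

module Quotient (G : FinAbGroup) {H : Subset G} (H-sub : IsSubgroup G H) where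
  open FinAbGroup G
  open GroupProperties G
  open SubsetProperties G using (⊆-antisym)

  private variable
    x y x′ y′ : Carrier

  _~_ : Carrier → Carrier → Set
  x ~ y = _∈ₛ_ G (x - y) H

  ~-reflexive : x ≡ y → x ~ y
  ~-reflexive {x} refl = subst (λ t → _∈ₛ_ G t H) (sym (+-invʳ x)) (proj₁ H-sub)

  ~-sym : x ~ y → y ~ x
  ~-sym {x} {y} x~y = subst (λ t → _∈ₛ_ G t H) (⁻¹-anti-homo‿- x y) (proj₂ (proj₂ H-sub) _ x~y)

  ~-trans : ∀ {x y z} → x ~ y → y ~ z → x ~ z
  ~-trans {x} {y} {z} x~y y~z =
    subst (λ t → _∈ₛ_ G t H) ([x-y]+[y-z]≡x-z x y z) (proj₁ (proj₂ H-sub) _ _ x~y y~z)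

  ~-+ : x ~ x′ → y ~ y′ → (x + y) ~ (x′ + y′)
  ~-+ {x} {x′} {y} {y′} x~x′ y~y′ =
    subst (λ t → _∈ₛ_ G t H) (sym ([x+y]-[u+v]≡[x-u]+[y-v] x y x′ y′)) (proj₁ (proj₂ H-sub) _ _ x~x′ y~y′)

  -- The canonical representative of the coset x + H is the first element of the enumeration
  -- lying in it; G/H is the set of elements that are their own representative.
  rep : Carrier → Carrier
  rep x = firstWith (λ y → H (x - y)) 0# elements

  x~rep : ∀ x → x ~ rep x
  x~rep x = firstWith-satisfies (λ y → H (x - y)) 0# (complete x) (~-reflexive refl)

  rep-cong : x ~ y → rep x ≡ rep y
  rep-cong x~y = firstWith-cong 0# elements
    (⊆-antisym (λ _ → ~-trans (~-sym x~y)) (λ _ → ~-trans x~y))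

  rep≡⇒~ : rep x ≡ rep y → x ~ y
  rep≡⇒~ {x} {y} rx≡ry = ~-trans (x~rep x) (subst (_~ y) (sym rx≡ry) (~-sym (x~rep y)))

  Coset : Set
  Coset = Σ Carrier λ x → rep x ≡ x

  π : Carrier → Coset
  π x = rep x , rep-cong (~-sym (x~rep x))

  coset-≡ : ∀ {p : rep x ≡ x} {q : rep y ≡ y} → x ≡ y → _≡_ {A = Coset} (x , p) (y , q)
  coset-≡ {p = p} {q} refl rewrite Decidable⇒UIP.≡-irrelevant _≟_ p q = refl

  π-cong : x ~ y → π x ≡ π y
  π-cong x~y = coset-≡ (rep-cong x~y)

  π-proj₁ : ∀ c → π (proj₁ c) ≡ c
  π-proj₁ (x , rx≡x) = coset-≡ rx≡x

  infixl 6 _+ᶜ_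
  _+ᶜ_ : Coset → Coset → Coset
  (x , _) +ᶜ (y , _) = π (x + y)

  _≟ᶜ_ : (c d : Coset) → Dec (c ≡ d)
  (x , _) ≟ᶜ (y , _) with x ≟ y
  ... | yes x≡y = yes (coset-≡ x≡y)
  ... | no x≢y  = no (x≢y ∘ cong proj₁)

  G/H : FinAbGroup
  G/H = record
    { Carrier  = Coset
    ; _+_      = _+ᶜ_
    ; 0#       = π 0#
    ; -_       = λ c → π (- proj₁ c)
    ; +-assoc  = λ { (x , _) (y , _) (z , _) → π-cong
        (~-trans (~-+ (~-sym (x~rep (x + y))) (~-reflexive refl))
        (~-trans (~-reflexive (+-assoc x y z)) (~-+ (~-reflexive refl) (x~rep (y + z))))) }
    ; +-comm   = λ { (x , _) (y , _) → cong π (+-comm x y) }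
    ; +-idʳ    = λ { (x , rx≡x) → trans
        (π-cong (~-trans (~-+ (~-reflexive refl) (~-sym (x~rep 0#))) (~-reflexive (+-idʳ x))))
        (coset-≡ rx≡x) }
    ; +-invʳ   = λ { (x , _) → π-cong
        (~-trans (~-+ (~-reflexive refl) (~-sym (x~rep (- x)))) (~-reflexive (+-invʳ x))) }
    ; _≟_      = _≟ᶜ_
    ; elements = map π elements
    ; complete = λ c → subst (_∈ map π elements) (π-proj₁ c) (∈-map⁺ π (complete (proj₁ c)))
    }

  π-isQuotientMap : IsQuotientMap G H G/H π
  π-isQuotientMap =
      (λ x y → π-cong (~-+ (x~rep x) (x~rep y)))
    , (λ c → proj₁ c , π-proj₁ c)
    , λ x → mk⇔ (λ πx≡π0 → subst (λ t → _∈ₛ_ G t H) (x-0≡x x) (rep≡⇒~ (cong proj₁ πx≡π0)))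
                (λ x∈H → π-cong (subst (λ t → _∈ₛ_ G t H) (sym (x-0≡x x)) x∈H))

module QuotientMapProperties (G Q : FinAbGroup) {H : Subset G}
  {π : FinAbGroup.Carrier G → FinAbGroup.Carrier Q} (π-quotient : IsQuotientMap G H Q π) where
  open FinAbGroup G
  open GroupProperties G using (+-identityˡ; _-_; x-y+y≡x)
  open SubsetProperties G
  open FinAbGroup Q using () renaming (_+_ to _+′_; 0# to 0#′; +-idʳ to +-idʳ′; _≟_ to _≟′_)
  open GroupProperties Q using () renaming (+-identityˡ to +-identityˡ′; cancelˡ to cancelˡ′; cancelʳ to cancelʳ′)
  module Q = SubsetProperties Q

  private variable
    x y : Carrier
    q : FinAbGroup.Carrier Q
    X Y : Subset G

  π-+ : ∀ x y → π (x + y) ≡ π x +′ π y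
  π-+ = proj₁ π-quotient

  π-surjective : ∀ q → ∃[ x ] (π x ≡ q)
  π-surjective = proj₁ (proj₂ π-quotient)

  π≡0⇒∈H : π x ≡ 0#′ → _∈ₛ_ G x H
  π≡0⇒∈H = Equivalence.to (proj₂ (proj₂ π-quotient) _)

  ∈H⇒π≡0 : _∈ₛ_ G x H → π x ≡ 0#′
  ∈H⇒π≡0 = Equivalence.from (proj₂ (proj₂ π-quotient) _)

  π-0 : π 0# ≡ 0#′
  π-0 = cancelˡ′ (π 0#) (π 0#) 0#′
    (trans (sym (π-+ 0# 0#)) (trans (cong π (+-idʳ 0#)) (sym (+-idʳ′ (π 0#)))))

  0∈H : P₀ G H
  0∈H = π≡0⇒∈H π-0

  π≡⇒-∈H : π x ≡ π y → _∈ₛ_ G (x - y) H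
  π≡⇒-∈H {x} {y} πx≡πy = π≡0⇒∈H (cancelʳ′ (π y) (π (x - y)) 0#′ (begin
    π (x - y) +′ π y   ≡⟨ π-+ (x - y) y ⟨
    π ((x - y) + y)    ≡⟨ cong π (x-y+y≡x x y) ⟩
    π x                ≡⟨ πx≡πy ⟩
    π y                ≡⟨ +-identityˡ′ (π y) ⟨
    0#′ +′ π y         ∎))
    where open ≡-Reasoning

  π-saturated : P₀[_] G H Y → _∈ₛ_ G y Y → π x ≡ π y → _∈ₛ_ G x Y
  π-saturated {Y} {y} {x} (Y′ , _ , Y≐H⊕Y′) y∈Y πx≡πy
    with ∈⊕⁻ H Y′ (≐⇒⊆ Y≐H⊕Y′ y y∈Y)
  ... | h , y′ , h∈H , y′∈Y′ , refl =
    ≐⇒⊆ (≐-sym Y≐H⊕Y′) x (∈⊕⁺ H Y′ (π≡⇒-∈H πx≡πy′) y′∈Y′ (sym (x-y+y≡x x y′)))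
    where
    πx≡πy′ : π x ≡ π y′
    πx≡πy′ = trans πx≡πy (trans (π-+ h y′)
               (trans (cong (_+′ π y′) (∈H⇒π≡0 h∈H)) (+-identityˡ′ (π y′))))

  image : Subset G → Subset Q
  image X q = any (λ x → X x ∧ ⌊ π x ≟′ q ⌋) elements

  ∈image⁺ : _∈ₛ_ G x X → π x ≡ q → _∈ₛ_ Q q (image X)
  ∈image⁺ {x} x∈X πx≡q = any⁺ _ (lose (complete x) (Equivalence.from T-∧ (x∈X , fromWitness πx≡q)))

  ∈image⁻ : _∈ₛ_ Q q (image X) → ∃[ x ] (_∈ₛ_ G x X × π x ≡ q)
  ∈image⁻ q∈ = let x , p = satisfied (any⁻ _ elements q∈)
                   x∈X , πx≡q = Equivalence.to T-∧ p
               in x , x∈X , toWitness πx≡q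

  image-mono : _⊆_ G X Y → _⊆_ Q (image X) (image Y)
  image-mono X⊆Y q q∈ = let x , x∈X , πx≡q = ∈image⁻ q∈ in ∈image⁺ (X⊆Y x x∈X) πx≡q

  image⊆⇒⊆ : P₀[_] G H Y → _⊆_ Q (image X) (image Y) → _⊆_ G X Y
  image⊆⇒⊆ Y-div iX⊆iY x x∈X =
    let y , y∈Y , πy≡πx = ∈image⁻ (iX⊆iY (π x) (∈image⁺ x∈X refl))
    in π-saturated Y-div y∈Y (sym πy≡πx)

  image-⊕ : ∀ X Y → _≐_ Q (image (_⊕_ G X Y)) (_⊕_ Q (image X) (image Y))
  image-⊕ X Y = Q.⊆-antisym
    (λ q q∈ → let z , z∈ , πz≡q = ∈image⁻ q∈
                  x , y , x∈X , y∈Y , z≡x+y = ∈⊕⁻ X Y z∈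
              in Q.∈⊕⁺ (image X) (image Y) (∈image⁺ x∈X refl) (∈image⁺ y∈Y refl)
                   (trans (sym πz≡q) (trans (cong π z≡x+y) (π-+ x y))))
    (λ q q∈ → let p , p′ , p∈ , p′∈ , q≡p+p′ = Q.∈⊕⁻ (image X) (image Y) q∈
                  x , x∈X , πx≡p = ∈image⁻ p∈
                  y , y∈Y , πy≡p′ = ∈image⁻ p′∈
              in ∈image⁺ (∈⊕⁺ X Y x∈X y∈Y refl)
                   (trans (π-+ x y) (trans (cong₂ _+′_ πx≡p πy≡p′) (sym q≡p+p′))))

  image-H : _≐_ Q (image H) (zeroSet Q)
  image-H = Q.⊆-antisym
    (λ q q∈ → let h , h∈H , πh≡q = ∈image⁻ q∈ in fromWitness (trans (sym πh≡q) (∈H⇒π≡0 h∈H)))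
    (λ q q∈ → ∈image⁺ 0∈H (trans π-0 (sym (Q.∈zeroSet⁻ q∈))))

  preimage : Subset Q → Subset G
  preimage Y x = Y (π x)

  image-H⊕preimage : ∀ Y → _≐_ Q (image (_⊕_ G H (preimage Y))) Y
  image-H⊕preimage Y = Q.⊆-antisym
    (λ q q∈ → let z , z∈ , πz≡q = ∈image⁻ q∈
                  h , x , h∈H , x∈ , z≡h+x = ∈⊕⁻ H (preimage Y) z∈
              in subst (λ t → _∈ₛ_ Q t Y)
                   (trans (sym (+-identityˡ′ (π x)))
                     (trans (cong (_+′ π x) (sym (∈H⇒π≡0 h∈H)))
                       (trans (sym (π-+ h x)) (trans (cong π (sym z≡h+x)) πz≡q)))) x∈)
    (λ q q∈ → let x , πx≡q = π-surjective q
              in ∈image⁺ (∈⊕⁺ H (preimage Y) 0∈H (subst (λ t → _∈ₛ_ Q t Y) (sym πx≡q) q∈)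
                           (sym (+-identityˡ x))) πx≡q)

  image-isMonoidIso : IsMonoidIso G H Q image
  image-isMonoidIso =
      (λ X Y X≐Y → Q.⊆-antisym (image-mono (≐⇒⊆ X≐Y)) (image-mono (≐⇒⊆ (≐-sym X≐Y))))
    , (λ X X-div → ∈image⁺ (P₀[]⇒P₀ {H = H} 0∈H X-div) π-0)
    , (λ X Y _ _ → image-⊕ X Y)
    , image-H
    , (λ X Y X-div Y-div iX≐iY → ⊆-antisym (image⊆⇒⊆ Y-div (Q.≐⇒⊆ iX≐iY))
                                            (image⊆⇒⊆ X-div (Q.≐⇒⊆ (Q.≐-sym iX≐iY))))
    , λ Y 0∈Y → _⊕_ G H (preimage Y)
              , (preimage Y , subst (λ t → _∈ₛ_ Q t Y) (sym π-0) 0∈Y , ≐-refl)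
              , image-H⊕preimage Y

lemma3p1 : (G : FinAbGroup) → NonTrivial G
    → (H : Subset G) → IsSubgroup G H
    → (f : Subset G → Subset G) → IsAutP₀ G f → TrivialPullback G f
    -- (1)
    → (_≐_ G (f H) H
       × IsAutOn G (λ X → P₀ G X × _⊆_ G X H) (zeroSet G) f
       × (∀ a → _∈ₛ_ G a H → _≐_ G (f (pair0 G a)) (pair0 G a)))
    -- (2)
    × ((Σ FinAbGroup λ Q → Σ (FinAbGroup.Carrier G → FinAbGroup.Carrier Q) λ π →
          IsQuotientMap G H Q π × ∃[ φ ] IsMonoidIso G H Q φ)
       × IsAutOn G (P₀[_] G H) H f)
    -- (3)
    × (∀ a → a ≢ FinAbGroup.0# G →
          ∃[ b ] (_≐_ G (f (G∖ G a)) (G∖ G b))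
        × (∀ n → IsOrder G a n → 3 ≤ n → _≐_ G (f (G∖ G a)) (G∖ G a)))
lemma3p1 G _ H H-sub f f-aut trivial =
    (fH≐H , isAutOn-⊆ H-sub fH≐H , λ a _ → trivial a)
  , ( (G/H , π , π-isQuotientMap , image , image-isMonoidIso)
    , isAutOn-P₀[] (proj₁ H-sub) fH≐H)
  , λ a a≢0 → let b , fG∖a≐G∖b = f-G∖ trivial a≢0
              in b , fG∖a≐G∖b , λ n a-order 3≤n → f-G∖-fixed trivial (order≥3⇒a+a≢0 a-order 3≤n)
  where
  open GroupProperties G using (order≥3⇒a+a≢0)
  open AutomorphismProperties G f-aut
  open Quotient G H-sub using (G/H; π; π-isQuotientMap)
  open QuotientMapProperties G G/H π-isQuotientMap using (image; image-isMonoidIso)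

  fH≐H : _≐_ G (f H) H
  fH≐H = f-subgroup trivial H-sub
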